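{- Let $R$ be a commutative ring with unit, $(G,\Gamma)$ a Hecke pair, $V$ an $R[G]$-module, $g\in G$, $q\ge 0$, and write $\Gamma g\Gamma=\dot\bigcup_{j=1}^n g_j\Gamma$ as a disjoint union of left cosets. Let $v\in H_q^0(\Gamma,V)$. Then: (a) $\sum_{j=1}^n g_jv\in H_q^0(\Gamma(g),V)$; (b) for any choice of elements $\gamma_1,\dots,\gamma_n\in\Gamma$, $\sum_{j=1}^n g_j(\gamma_j-1)v\in H_{q-1}^0(\Gamma(g),V)$.
   Context: A Hecke pair $(G,\Gamma)$ is a group $G$ with a subgroup $\Gamma$ such that for every $g\in G$ the set $\Gamma g\Gamma/\Gamma$ is finite. For a subgroup $\Sigma$ of $G$ let $I_\Sigma\subset R[\Sigma]$ be the augmentation ideal (spanned by the $\sigma-1$, $\sigma\in\Sigma$), and for an $R[G]$-module $V$ and $q\ge 0$ put $H_q^0(\Sigma,V)=\{v\in V: I_\Sigma^{q+1}v=0\}$; also $H_{ -1}^0(\Sigma,V)=0$. The group $\Gamma$ permutes the finite set $\Gamma g\Gamma/\Gamma$ by left multiplication; $\Gamma(g)\subset\Gamma$ denotes the subgroup of elements acting trivially on this set (equivalently $\Gamma(g)=\bigcap_{\gamma\in\Gamma}\gamma(\Gamma\cap g\Gamma g^{ -1})\gamma^{ -1}$), a finite-index normal subgroup of $\Gamma$. -}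

module Defs where

open import Level using (Level; _⊔_; suc)
open import Algebra.Bundles using (Group; CommutativeRing)
open import Algebra.Module.Bundles using (Module)
open import Data.Nat using (ℕ; zero) renaming (suc to sucℕ)
open import Data.Fin using (Fin; zero) renaming (suc to fsuc)
open import Data.Product using (Σ; ∃; ∃-syntax; _×_; _,_)
open import Relation.Unary using (Pred; _∈_)
open import Relation.Binary.PropositionalEquality using (_≡_)

record Subgroup {c ℓ} (G : Group c ℓ) (p : Level) : Set (c ⊔ ℓ ⊔ suc p) where
  open Group G
  field
    mem      : Pred Carrier p
    resp     : ∀ {x y} → x ≈ y → mem x → mem y
    ε-mem    : mem ε
    ∙-mem    : ∀ {x y} → mem x → mem y → mem (x ∙ y)
    ⁻¹-mem   : ∀ {x} → mem x → mem (x ⁻¹)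

module _ {c ℓ p} (G : Group c ℓ) (Γ : Subgroup G p) where
  open Group G
  open Subgroup Γ

  InDouble : Carrier → Pred Carrier (c ⊔ ℓ ⊔ p)
  InDouble g x = ∃[ γ ] ∃[ γ′ ] (mem γ × mem γ′ × x ≈ (γ ∙ g) ∙ γ′)

  IsCosetDecomposition : Carrier → (n : ℕ) → (Fin n → Carrier) → Set (c ⊔ ℓ ⊔ p)
  IsCosetDecomposition g n gs =
      (∀ j → InDouble g (gs j))
    × (∀ x → InDouble g x → ∃[ j ] mem (gs j ⁻¹ ∙ x))
    × (∀ i j → mem (gs i ⁻¹ ∙ gs j) → i ≡ j)

  IsHeckePair : Set (c ⊔ ℓ ⊔ p)
  IsHeckePair = ∀ g → ∃[ n ] ∃[ gs ] IsCosetDecomposition g n gs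

  -- Γ(g): the elements of Γ acting trivially (by left multiplication)
  -- on the set of left cosets Γ g Γ / Γ, i.e. γ x Γ = x Γ for all x ∈ Γ g Γ.
  Γ⟨_⟩ : Carrier → Pred Carrier (c ⊔ ℓ ⊔ p)
  Γ⟨ g ⟩ γ = mem γ × (∀ x → InDouble g x → mem (x ⁻¹ ∙ (γ ∙ x)))

record RGModule {r ℓr c ℓ} (R : CommutativeRing r ℓr) (G : Group c ℓ) (m ℓm : Level)
       : Set (r ⊔ ℓr ⊔ c ⊔ ℓ ⊔ suc (m ⊔ ℓm)) where
  open Group G
  open CommutativeRing R using () renaming (Carrier to Rc)
  field
    module′ : Module R m ℓm
  open Module module′
  field
    act       : Carrier → Carrierᴹ → Carrierᴹ
    act-cong  : ∀ {g h u w} → g ≈ h → u ≈ᴹ w → act g u ≈ᴹ act h w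
    act-ε     : ∀ u → act ε u ≈ᴹ u
    act-∙     : ∀ g h u → act (g ∙ h) u ≈ᴹ act g (act h u)
    act-+     : ∀ g u w → act g (u +ᴹ w) ≈ᴹ act g u +ᴹ act g w
    act-*ₗ    : ∀ g (a : Rc) u → act g (a *ₗ u) ≈ᴹ a *ₗ act g u

module _ {r ℓr c ℓ m ℓm} {R : CommutativeRing r ℓr} {G : Group c ℓ}
         (V : RGModule R G m ℓm) where
  open Group G
  open RGModule V
  open Module module′

  _−1·_ : Carrier → Carrierᴹ → Carrierᴹ
  σ −1· u = act σ u +ᴹ (-ᴹ u)

  ∑ : (n : ℕ) → (Fin n → Carrierᴹ) → Carrierᴹ
  ∑ zero    f = 0ᴹ
  ∑ (sucℕ n) f = f zero +ᴹ ∑ n (λ j → f (fsuc j))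

  prodAug : (k : ℕ) → (Fin k → Carrier) → Carrierᴹ → Carrierᴹ
  prodAug zero    σ u = u
  prodAug (sucℕ k) σ u = σ zero −1· prodAug k (λ i → σ (fsuc i)) u

  -- Killed k S u :  I_S^k u = 0  (I_S^k is R-spanned by the products
  -- (σ₁-1)⋯(σ_k-1), σ_i ∈ S; for k = 0 this says u = 0).
  -- Hence H_q^0(S,V) = Killed (1+q) S and H_{-1}^0(S,V) = Killed 0 S = 0.
  Killed : ∀ {p} → ℕ → Pred Carrier p → Pred Carrierᴹ (c ⊔ p ⊔ ℓm)
  Killed k S u = ∀ (σ : Fin k → Carrier) → (∀ i → σ i ∈ S) → prodAug k σ u ≈ᴹ 0ᴹ

{-# OPTIONS --safe #-}
module Submission where

-- For σ ∈ Γ(g) and a representative g_j ∈ ΓgΓ, the conjugate g_j⁻¹ σ g_j lies in Γ,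
-- and (σ - 1) g_j w = g_j (g_j⁻¹ σ g_j - 1) w. Hence a product of k factors σ_i - 1 with
-- σ_i ∈ Γ(g) carries ∑ g_j w_j to ∑ g_j P_j w_j, each P_j a product of k factors τ - 1
-- with τ ∈ Γ; this vanishes as soon as I_Γ^k kills every w_j. For (a) take k = q+1 and
-- w_j = v; for (b) take k = q and w_j = (γ_j - 1) v, killed by I_Γ^q since I_Γ^{q+1} kills v.

open import Defs
open import Algebra.Bundles using (Group; AbelianGroup; CommutativeRing)
open import Algebra.Module.Bundles using (Module)
open import Data.Nat using (ℕ; zero; suc)
open import Data.Fin using (Fin; fromℕ) renaming (zero to fzero; suc to fsuc)
open import Data.Vec.Functional using (Vector; insertAt; head; tail)
open import Data.Product using (_×_; _,_)
open import Relation.Unary using (Pred)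
open import Relation.Binary.PropositionalEquality as ≡ using (_≡_)
import Algebra.Properties.Group as GroupProperties
import Algebra.Properties.AbelianGroup as AbelianGroupProperties
import Algebra.Properties.CommutativeSemigroup as CommutativeSemigroupProperties
import Relation.Binary.Reasoning.Setoid as SetoidReasoning

insertAt-all : ∀ {a p} {A : Set a} (P : Pred A p) {n} (xs : Vector A n) (i : Fin (suc n)) {x : A} →
               (∀ j → P (xs j)) → P x → ∀ j → P (insertAt xs i x j)
insertAt-all P         xs fzero    Pxs Px fzero    = Px
insertAt-all P         xs fzero    Pxs Px (fsuc j) = Pxs j
insertAt-all P {suc n} xs (fsuc i) Pxs Px fzero    = Pxs fzero
insertAt-all P {suc n} xs (fsuc i) Pxs Px (fsuc j) = insertAt-all P (tail xs) i (λ j → Pxs (fsuc j)) Px j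

module _ {r ℓr c ℓ m ℓm} {R : CommutativeRing r ℓr} {G : Group c ℓ}
         (V : RGModule R G m ℓm) where
  open Group G
  open RGModule V
  open Module module′
  open CommutativeRing R using (0#)
  open GroupProperties (AbelianGroup.group +ᴹ-abelianGroup) using (inverseˡ-unique)
  open AbelianGroupProperties +ᴹ-abelianGroup using (⁻¹-∙-comm)
  open CommutativeSemigroupProperties (AbelianGroup.commutativeSemigroup +ᴹ-abelianGroup)
    using (interchange)
  open SetoidReasoning ≈ᴹ-setoid

  act-0ᴹ : ∀ x → act x 0ᴹ ≈ᴹ 0ᴹ
  act-0ᴹ x = begin
    act x 0ᴹ          ≈⟨ act-cong refl (≈ᴹ-sym (*ₗ-zeroˡ 0ᴹ)) ⟩
    act x (0# *ₗ 0ᴹ)  ≈⟨ act-*ₗ x 0# 0ᴹ ⟩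
    0# *ₗ act x 0ᴹ    ≈⟨ *ₗ-zeroˡ _ ⟩
    0ᴹ                ∎

  act--ᴹ : ∀ x u → act x (-ᴹ u) ≈ᴹ -ᴹ act x u
  act--ᴹ x u = inverseˡ-unique _ _ (begin
    act x (-ᴹ u) +ᴹ act x u  ≈⟨ ≈ᴹ-sym (act-+ x (-ᴹ u) u) ⟩
    act x (-ᴹ u +ᴹ u)        ≈⟨ act-cong refl (-ᴹ‿inverseˡ u) ⟩
    act x 0ᴹ                 ≈⟨ act-0ᴹ x ⟩
    0ᴹ                       ∎)

  ∑-cong : ∀ n {f h : Fin n → Carrierᴹ} → (∀ j → f j ≈ᴹ h j) → ∑ V n f ≈ᴹ ∑ V n h
  ∑-cong zero    f≈h = ≈ᴹ-refl
  ∑-cong (suc n) f≈h = +ᴹ-cong (f≈h fzero) (∑-cong n (λ j → f≈h (fsuc j)))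

  ∑-0ᴹ : ∀ n {f : Fin n → Carrierᴹ} → (∀ j → f j ≈ᴹ 0ᴹ) → ∑ V n f ≈ᴹ 0ᴹ
  ∑-0ᴹ zero    f≈0 = ≈ᴹ-refl
  ∑-0ᴹ (suc n) f≈0 = ≈ᴹ-trans (+ᴹ-cong (f≈0 fzero) (∑-0ᴹ n (λ j → f≈0 (fsuc j)))) (+ᴹ-identityˡ 0ᴹ)

  −1·-cong : ∀ σ {u w} → u ≈ᴹ w → _−1·_ V σ u ≈ᴹ _−1·_ V σ w
  −1·-cong σ u≈w = +ᴹ-cong (act-cong refl u≈w) (-ᴹ‿cong u≈w)

  −1·-0ᴹ : ∀ σ → _−1·_ V σ 0ᴹ ≈ᴹ 0ᴹ
  −1·-0ᴹ σ = ≈ᴹ-trans (+ᴹ-cong (act-0ᴹ σ) ≈ᴹ-refl) (-ᴹ‿inverseʳ 0ᴹ)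

  −1·-+ᴹ : ∀ σ u w → _−1·_ V σ (u +ᴹ w) ≈ᴹ _−1·_ V σ u +ᴹ _−1·_ V σ w
  −1·-+ᴹ σ u w = begin
    act σ (u +ᴹ w) +ᴹ -ᴹ (u +ᴹ w)          ≈⟨ +ᴹ-cong (act-+ σ u w) (≈ᴹ-sym (⁻¹-∙-comm u w)) ⟩
    (act σ u +ᴹ act σ w) +ᴹ (-ᴹ u +ᴹ -ᴹ w)  ≈⟨ interchange _ _ _ _ ⟩
    (act σ u +ᴹ -ᴹ u) +ᴹ (act σ w +ᴹ -ᴹ w)  ∎

  −1·-∑ : ∀ σ n (f : Fin n → Carrierᴹ) → _−1·_ V σ (∑ V n f) ≈ᴹ ∑ V n (λ j → _−1·_ V σ (f j))
  −1·-∑ σ zero    f = −1·-0ᴹ σ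
  −1·-∑ σ (suc n) f = ≈ᴹ-trans (−1·-+ᴹ σ _ _) (+ᴹ-cong ≈ᴹ-refl (−1·-∑ σ n _))

  −1·-act : ∀ σ x u → _−1·_ V σ (act x u) ≈ᴹ act x (_−1·_ V (x ⁻¹ ∙ (σ ∙ x)) u)
  −1·-act σ x u = ≈ᴹ-sym (begin
    act x (act τ u +ᴹ -ᴹ u)          ≈⟨ act-+ x _ _ ⟩
    act x (act τ u) +ᴹ act x (-ᴹ u)  ≈⟨ +ᴹ-cong (≈ᴹ-sym (act-∙ x τ u)) (act--ᴹ x u) ⟩
    act (x ∙ τ) u +ᴹ -ᴹ act x u      ≈⟨ +ᴹ-cong (act-cong x∙τ≈σ∙x ≈ᴹ-refl) ≈ᴹ-refl ⟩
    act (σ ∙ x) u +ᴹ -ᴹ act x u      ≈⟨ +ᴹ-cong (act-∙ σ x u) ≈ᴹ-refl ⟩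
    act σ (act x u) +ᴹ -ᴹ act x u    ∎)
    where
    τ = x ⁻¹ ∙ (σ ∙ x)
    x∙τ≈σ∙x : x ∙ τ ≈ σ ∙ x
    x∙τ≈σ∙x = trans (sym (assoc _ _ _)) (trans (∙-congʳ (inverseʳ x)) (identityˡ _))

  prodAug-∑-act : ∀ k (σ : Fin k → Carrier) n (xs : Fin n → Carrier) (w : Fin n → Carrierᴹ) →
    prodAug V k σ (∑ V n (λ j → act (xs j) (w j)))
      ≈ᴹ ∑ V n (λ j → act (xs j) (prodAug V k (λ i → xs j ⁻¹ ∙ (σ i ∙ xs j)) (w j)))
  prodAug-∑-act zero    σ n xs w = ≈ᴹ-refl
  prodAug-∑-act (suc k) σ n xs w = begin
    _−1·_ V (head σ) (prodAug V k (tail σ) (∑ V n (λ j → act (xs j) (w j))))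
      ≈⟨ −1·-cong (head σ) (prodAug-∑-act k (tail σ) n xs w) ⟩
    _−1·_ V (head σ) (∑ V n (λ j → act (xs j) (conjugated j)))
      ≈⟨ −1·-∑ (head σ) n _ ⟩
    ∑ V n (λ j → _−1·_ V (head σ) (act (xs j) (conjugated j)))
      ≈⟨ ∑-cong n (λ j → −1·-act (head σ) (xs j) _) ⟩
    _ ∎
    where
    conjugated : Fin n → Carrierᴹ
    conjugated j = prodAug V k (λ i → xs j ⁻¹ ∙ (tail σ i ∙ xs j)) (w j)

  prodAug-insertAt-last : ∀ k (σ : Fin k → Carrier) a u →
    prodAug V k σ (_−1·_ V a u) ≡ prodAug V (suc k) (insertAt σ (fromℕ k) a) u
  prodAug-insertAt-last zero    σ a u = ≡.refl
  prodAug-insertAt-last (suc k) σ a u = ≡.cong (_−1·_ V (head σ)) (prodAug-insertAt-last k (tail σ) a u)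

  Killed-−1· : ∀ {p k} {S : Pred Carrier p} {u a} → Killed V (suc k) S u → S a → Killed V k S (_−1·_ V a u)
  Killed-−1· {k = k} {S} {u} {a} u-killed a∈S σ σ∈S =
    ≈ᴹ-trans (≈ᴹ-reflexive (prodAug-insertAt-last k σ a u))
             (u-killed _ (insertAt-all S σ (fromℕ k) σ∈S a∈S))

  Killed-∑-act : ∀ {p p′ k n} {S : Pred Carrier p} {T : Pred Carrier p′}
                 {xs : Fin n → Carrier} {w : Fin n → Carrierᴹ} →
                 (∀ j {σ} → S σ → T (xs j ⁻¹ ∙ (σ ∙ xs j))) →
                 (∀ j → Killed V k T (w j)) →
                 Killed V k S (∑ V n (λ j → act (xs j) (w j)))
  Killed-∑-act {k = k} {n} {xs = xs} {w} conjugate w-killed σ σ∈S =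
    ≈ᴹ-trans (prodAug-∑-act k σ n xs w)
             (∑-0ᴹ n (λ j → ≈ᴹ-trans (act-cong refl (w-killed j _ (λ i → conjugate j (σ∈S i))))
                                     (act-0ᴹ (xs j))))

lemma1p2p2 : ∀ {r ℓr c ℓ p m ℓm}
    (R : CommutativeRing r ℓr) (G : Group c ℓ) (Γ : Subgroup G p) →
    IsHeckePair G Γ →
    (V : RGModule R G m ℓm) →
    (g : Group.Carrier G) (q : ℕ) (n : ℕ) (gs : Fin n → Group.Carrier G) →
    IsCosetDecomposition G Γ g n gs →
    (v : Module.Carrierᴹ (RGModule.module′ V)) →
    Killed V (suc q) (Subgroup.mem Γ) v →
    Killed V (suc q) (Γ⟨_⟩ G Γ g) (∑ V n (λ j → RGModule.act V (gs j) v))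
    × (∀ (γs : Fin n → Group.Carrier G) → (∀ j → Subgroup.mem Γ (γs j)) →
        Killed V q (Γ⟨_⟩ G Γ g)
          (∑ V n (λ j → RGModule.act V (gs j) (_−1·_ V (γs j) v))))
lemma1p2p2 R G Γ _ V g q n gs (gs∈ΓgΓ , _) v v-killed =
    Killed-∑-act V {T = Subgroup.mem Γ} conjugate (λ _ → v-killed)
  , λ γs γs∈Γ → Killed-∑-act V {T = Subgroup.mem Γ} conjugate
                  (λ j → Killed-−1· V {S = Subgroup.mem Γ} v-killed (γs∈Γ j))
  where
  open Group G using (_∙_; _⁻¹)
  conjugate : ∀ j {σ} → Γ⟨_⟩ G Γ g σ → Subgroup.mem Γ (gs j ⁻¹ ∙ (σ ∙ gs j))
  conjugate j (_ , fixes-cosets) = fixes-cosets (gs j) (gs∈ΓgΓ j)
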